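{- In the non-preemptive sUETS problem, the online algorithm that assigns the single batch $J$ (all jobs) to one machine is $m$-competitive.
   Context: Non-preemptive sUETS: a finite set $J$ of $n$ jobs and $m$ identical machines, $n\ge m\ge 2$, all jobs available at time $0$. A known setup-time function $c:2^J\to\mathbb{R}_{\ge0}$ is monotone ($c(X)\le c(Y)$ for $X\subseteq Y$) and subadditive ($c(X)+c(Y)\ge c(X\cup Y)$ for disjoint $X,Y$). Each job $j$ has execution time $p_j\ge0$, unknown to an online algorithm until $j$ completes; $p(X)=\sum_{j\in X}p_j$. An algorithm repeatedly forms batches (sets of jobs not completed and not assigned elsewhere) and assigns each batch to a single idle machine, which processes batch $X$ without interruption in time $c(X)+p(X)$. The makespan is the completion time of all jobs. The optimal makespan is $\min_{(X_1,\dots,X_m)\text{ partition of }J}\max_{i}(c(X_i)+p(X_i))$. An algorithm is $\rho$-competitive if its makespan is at most $\rho$ times the optimal makespan on every instance.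
   Formalization: The setup times $c(X)$ and the execution times $p_j$ are nonnegative rationals rather than nonnegative reals. -}

module Defs where

open import Data.Nat using (ℕ; zero; suc)
open import Data.Fin using (Fin; zero; suc; _≟_)
open import Data.Fin.Subset using (Subset; inside; outside; _∈_; _∉_; _⊆_; _∪_; ⊤)
open import Data.Vec using (Vec; []; _∷_; tabulate)
open import Data.Bool using (Bool; true; false)
open import Data.Integer using (+_)
open import Data.Rational using (ℚ; 0ℚ; _+_; _*_; _⊔_; _≤_; _/_)
open import Relation.Nullary.Decidable using (⌊_⌋)

psum : ∀ {n} → (Fin n → ℚ) → Subset n → ℚ
psum {zero}  p []             = 0ℚ
psum {suc n} p (true  ∷ X)    = p zero + psum (λ j → p (suc j)) X
psum {suc n} p (false ∷ X)    = psum (λ j → p (suc j)) X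

Monotone : ∀ {n} → (Subset n → ℚ) → Set
Monotone c = ∀ X Y → X ⊆ Y → c X ≤ c Y

Disjoint : ∀ {n} → Subset n → Subset n → Set
Disjoint X Y = ∀ {j} → j ∈ X → j ∉ Y

Subadditive : ∀ {n} → (Subset n → ℚ) → Set
Subadditive c = ∀ X Y → Disjoint X Y → c (X ∪ Y) ≤ c X + c Y

-- An ordered partition (X_1,…,X_m) of J (parts may be empty) is given by
-- an assignment of every job to a machine; block i is the set of jobs sent to i.
block : ∀ {n m} → (Fin n → Fin m) → Fin m → Subset n
block f i = tabulate (λ j → ⌊ f j ≟ i ⌋)

maxFin : ∀ {m} → (Fin m → ℚ) → ℚ
maxFin {zero}  g = 0ℚ
maxFin {suc m} g = g zero ⊔ maxFin (λ i → g (suc i))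

partitionMakespan : ∀ {n m} → (Subset n → ℚ) → (Fin n → ℚ) → (Fin n → Fin m) → ℚ
partitionMakespan c p f = maxFin (λ i → c (block f i) + psum p (block f i))

-- The online algorithm that assigns the single batch J (all jobs) to one
-- machine at time 0: its makespan is c(J) + p(J).
singleBatchMakespan : ∀ {n} → (Subset n → ℚ) → (Fin n → ℚ) → ℚ
singleBatchMakespan c p = c ⊤ + psum p ⊤

ℕ→ℚ : ℕ → ℚ
ℕ→ℚ m = + m / 1

{-# OPTIONS --safe #-}
module Submission where

-- The load d(X) = c(X) + p(X) of a batch is subadditive on disjoint sets, since c is and p is
-- additive.  Splitting J into the blocks X₁, …, Xₘ of any partition therefore gives
-- d(J) ≤ d(X₁) + ⋯ + d(Xₘ) ≤ m · maxᵢ d(Xᵢ).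

open import Defs
open import Data.Nat using (ℕ) renaming (_≤_ to _≤ℕ_)
open import Data.Fin using (Fin)
open import Data.Fin.Subset using (Subset)
open import Data.Rational using (ℚ; 0ℚ; _*_; _≤_)

open import Algebra.Bundles using (CommutativeMonoid)
open import Data.Bool using (true; false)
open import Data.Bool.Properties using (T-≡)
open import Data.Fin using (zero; suc)
open import Data.Fin.Properties using (suc-injective)
open import Data.Fin.Subset using (_∈_; _∪_; ⊤)
open import Data.Fin.Subset.Properties using (⊆-antisym; ⊆⊤; x∈p∪q⁺; x∈p∪q⁻)
import Data.Integer as ℤ
import Data.Integer.Properties as ℤP
import Data.Nat.Coprimality as Coprime
open import Data.Nat using (zero; suc)
open import Data.Product using (∃; _,_)
open import Data.Rational using (mkℚ; 1ℚ; _+_)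
open import Data.Rational.Properties
  using (≤-trans; ≤-reflexive; +-mono-≤; p≤p⊔q; p≤q⊔p; *-distribʳ-+; *-identityˡ;
         normalize-coprime; /-cong; +-assoc; +-0-commutativeMonoid; module ≤-Reasoning)
open import Data.Sum using (inj₁; inj₂)
open import Data.Vec using ([]; _∷_; here; there)
open import Data.Vec.Properties using (lookup∘tabulate; []=⇒lookup; lookup⇒[]=)
open import Function using (_∘_; _⇔_; mk⇔; Equivalence)
open import Relation.Nullary.Decidable using (toWitness; fromWitness)
open import Relation.Binary.PropositionalEquality using (_≡_; _≢_; refl; sym; trans; cong; module ≡-Reasoning)

open import Algebra.Properties.CommutativeSemigroup
  (CommutativeMonoid.commutativeSemigroup +-0-commutativeMonoid) using (interchange; x∙yz≈y∙xz)

private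
  variable
    n m : ℕ

ℕ→ℚ-suc : ∀ k → ℕ→ℚ (suc k) ≡ 1ℚ + ℕ→ℚ k
ℕ→ℚ-suc k = begin
  -- 1ℚ + mkℚ (+ k) 0 _ unfolds to (1 * 1 + k * 1) / (1 * 1)
  ℕ→ℚ (suc k)                                 ≡⟨ /-cong (cong (ℤ._+_ ℤ.1ℤ) (sym (ℤP.*-identityʳ (ℤ.+ k)))) refl ⟩
  1ℚ + mkℚ (ℤ.+ k) 0 k/1-coprime               ≡⟨ cong (1ℚ +_) (sym (normalize-coprime k/1-coprime)) ⟩
  1ℚ + ℕ→ℚ k                                  ∎
  where
  open ≡-Reasoning
  k/1-coprime = Coprime.sym (Coprime.1-coprimeTo k)

ℕ→ℚ-suc-* : ∀ k M → ℕ→ℚ (suc k) * M ≡ M + ℕ→ℚ k * M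
ℕ→ℚ-suc-* k M = begin
  ℕ→ℚ (suc k) * M      ≡⟨ cong (_* M) (ℕ→ℚ-suc k) ⟩
  (1ℚ + ℕ→ℚ k) * M     ≡⟨ *-distribʳ-+ M 1ℚ (ℕ→ℚ k) ⟩
  1ℚ * M + ℕ→ℚ k * M   ≡⟨ cong (_+ ℕ→ℚ k * M) (*-identityˡ M) ⟩
  M + ℕ→ℚ k * M        ∎
  where open ≡-Reasoning

≤-maxFin : (g : Fin m → ℚ) (i : Fin m) → g i ≤ maxFin g
≤-maxFin g zero    = p≤p⊔q (g zero) _
≤-maxFin g (suc i) = ≤-trans (≤-maxFin (g ∘ suc) i) (p≤q⊔p (g zero) _)

drop-∷-Disjoint : ∀ {x y} {X Y : Subset n} → Disjoint (x ∷ X) (y ∷ Y) → Disjoint X Y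
drop-∷-Disjoint X#Y j∈X j∈Y = X#Y (there j∈X) (there j∈Y)

psum-∪ : (p : Fin n → ℚ) {X Y : Subset n} → Disjoint X Y → psum p (X ∪ Y) ≡ psum p X + psum p Y
psum-∪ p {[]}        {[]}        X#Y = refl
psum-∪ p {true ∷ X}  {true ∷ Y}  X#Y with () ← X#Y here here
psum-∪ p {true ∷ X}  {false ∷ Y} X#Y =
  trans (cong (p zero +_) (psum-∪ (p ∘ suc) (drop-∷-Disjoint X#Y)))
        (sym (+-assoc (p zero) _ _))
psum-∪ p {false ∷ X} {true ∷ Y}  X#Y =
  trans (cong (p zero +_) (psum-∪ (p ∘ suc) (drop-∷-Disjoint X#Y)))
        (x∙yz≈y∙xz (p zero) (psum (p ∘ suc) X) (psum (p ∘ suc) Y))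
psum-∪ p {false ∷ X} {false ∷ Y} X#Y = psum-∪ (p ∘ suc) (drop-∷-Disjoint X#Y)

psum-subadditive : (p : Fin n → ℚ) → Subadditive (psum p)
psum-subadditive p X Y X#Y = ≤-reflexive (psum-∪ p X#Y)

+-subadditive : (c d : Subset n → ℚ) → Subadditive c → Subadditive d → Subadditive (λ X → c X + d X)
+-subadditive c d c-sub d-sub X Y X#Y = begin
  c (X ∪ Y) + d (X ∪ Y)       ≤⟨ +-mono-≤ (c-sub X Y X#Y) (d-sub X Y X#Y) ⟩
  (c X + c Y) + (d X + d Y)   ≡⟨ interchange (c X) (c Y) (d X) (d Y) ⟩
  (c X + d X) + (c Y + d Y)   ∎
  where open ≤-Reasoning

-- Only nonempty families: the empty union would bring in d(∅), which need not be 0.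
⋃⁺ : (Fin (suc m) → Subset n) → Subset n
⋃⁺ {zero}  X = X zero
⋃⁺ {suc m} X = X zero ∪ ⋃⁺ (X ∘ suc)

∈⋃⁺⁺ : (X : Fin (suc m) → Subset n) {j : Fin n} (i : Fin (suc m)) → j ∈ X i → j ∈ ⋃⁺ X
∈⋃⁺⁺ {zero}  X zero    j∈Xi = j∈Xi
∈⋃⁺⁺ {suc m} X zero    j∈Xi = x∈p∪q⁺ (inj₁ j∈Xi)
∈⋃⁺⁺ {suc m} X (suc i) j∈Xi = x∈p∪q⁺ (inj₂ (∈⋃⁺⁺ (X ∘ suc) i j∈Xi))

∈⋃⁺⁻ : (X : Fin (suc m) → Subset n) {j : Fin n} → j ∈ ⋃⁺ X → ∃ λ i → j ∈ X i
∈⋃⁺⁻ {zero}  X j∈⋃X = zero , j∈⋃X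
∈⋃⁺⁻ {suc m} X j∈⋃X with x∈p∪q⁻ (X zero) (⋃⁺ (X ∘ suc)) j∈⋃X
... | inj₁ j∈X₀ = zero , j∈X₀
... | inj₂ j∈⋃X′ with i , j∈Xi ← ∈⋃⁺⁻ (X ∘ suc) j∈⋃X′ = suc i , j∈Xi

PairwiseDisjoint : (Fin m → Subset n) → Set
PairwiseDisjoint X = ∀ i k → i ≢ k → Disjoint (X i) (X k)

⋃⁺-subadditive : (d : Subset n → ℚ) → Subadditive d →
                 (X : Fin (suc m) → Subset n) → PairwiseDisjoint X →
                 (M : ℚ) → (∀ i → d (X i) ≤ M) → d (⋃⁺ X) ≤ ℕ→ℚ (suc m) * M
⋃⁺-subadditive {m = zero}  d d-sub X X-disj M d[Xi]≤M = begin
  d (X zero)  ≤⟨ d[Xi]≤M zero ⟩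
  M           ≡⟨ sym (*-identityˡ M) ⟩
  1ℚ * M      ∎
  where open ≤-Reasoning
⋃⁺-subadditive {m = suc m} d d-sub X X-disj M d[Xi]≤M = begin
  d (X zero ∪ ⋃⁺ (X ∘ suc))      ≤⟨ d-sub (X zero) (⋃⁺ (X ∘ suc)) X₀#⋃X′ ⟩
  d (X zero) + d (⋃⁺ (X ∘ suc))  ≤⟨ +-mono-≤ (d[Xi]≤M zero)
                                               (⋃⁺-subadditive d d-sub (X ∘ suc) X′-disj M (d[Xi]≤M ∘ suc)) ⟩
  M + ℕ→ℚ (suc m) * M            ≡⟨ sym (ℕ→ℚ-suc-* (suc m) M) ⟩
  ℕ→ℚ (suc (suc m)) * M          ∎
  where
  open ≤-Reasoning
  X₀#⋃X′ : Disjoint (X zero) (⋃⁺ (X ∘ suc))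
  X₀#⋃X′ j∈X₀ j∈⋃X′ with i , j∈Xi ← ∈⋃⁺⁻ (X ∘ suc) j∈⋃X′ = X-disj zero (suc i) (λ ()) j∈X₀ j∈Xi
  X′-disj : PairwiseDisjoint (X ∘ suc)
  X′-disj i k i≢k = X-disj (suc i) (suc k) (i≢k ∘ suc-injective)

∈-block : (f : Fin n → Fin m) {i : Fin m} {j : Fin n} → j ∈ block f i ⇔ f j ≡ i
∈-block f {i} {j} = mk⇔
  (λ j∈Xi → toWitness (Equivalence.from T-≡ (trans (sym (lookup∘tabulate _ j)) ([]=⇒lookup j∈Xi))))
  (λ fj≡i → lookup⇒[]= j _ (trans (lookup∘tabulate _ j) (Equivalence.to T-≡ (fromWitness fj≡i))))

block-pairwiseDisjoint : (f : Fin n → Fin m) → PairwiseDisjoint (block f)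
block-pairwiseDisjoint f i k i≢k j∈Xi j∈Xk =
  i≢k (trans (sym (Equivalence.to (∈-block f) j∈Xi)) (Equivalence.to (∈-block f) j∈Xk))

⋃⁺-block : (f : Fin n → Fin (suc m)) → ⋃⁺ (block f) ≡ ⊤
⋃⁺-block f = ⊆-antisym ⊆⊤ (λ {j} _ → ∈⋃⁺⁺ (block f) (f j) (Equivalence.from (∈-block f) refl))

theorem2 : (n m : ℕ) → 2 ≤ℕ m → m ≤ℕ n →
    (c : Subset n → ℚ) → (∀ X → 0ℚ ≤ c X) → Monotone c → Subadditive c →
    (p : Fin n → ℚ) → (∀ j → 0ℚ ≤ p j) →
    (f : Fin n → Fin m) →
    singleBatchMakespan c p ≤ ℕ→ℚ m * partitionMakespan c p f
theorem2 n (suc m) _ _ c _ _ c-sub p _ f = begin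
  load ⊤                        ≡⟨ cong load (sym (⋃⁺-block f)) ⟩
  load (⋃⁺ (block f))           ≤⟨ ⋃⁺-subadditive load load-sub (block f) (block-pairwiseDisjoint f)
                                     (maxFin (load ∘ block f)) (≤-maxFin (load ∘ block f)) ⟩
  ℕ→ℚ (suc m) * maxFin (load ∘ block f) ∎
  where
  open ≤-Reasoning
  load : Subset n → ℚ
  load X = c X + psum p X
  load-sub : Subadditive load
  load-sub = +-subadditive c (psum p) c-sub (psum-subadditive p)
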